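{- For $\sigma\in\mathfrak S_n$, write $\sigma^r=\sigma'_n\cdots\sigma'_2\sigma'_1$ where $\sigma'_i=n+1-\sigma_i$. Then $i_3(1*\sigma)=\mathrm{maj}(\sigma^r)$.
   Context: For $\sigma\in\mathfrak S_n$, $1*\sigma\in\mathfrak S_{n+1}$ is the permutation $1(\sigma_1+1)(\sigma_2+1)\cdots(\sigma_n+1)$, i.e. the permutation beginning with $1$ whose last $n$ entries have the same relative order as $\sigma$. For $\pi\in\mathfrak S_m$ and $i\in[m-2]$, $c^3_i(\pi)$ is the number of $j>i+1$ such that $\pi_i\pi_{i+1}\pi_j$ (standardized) is an odd permutation in $\mathfrak S_3$, and $i_3(\pi)=\sum_{i=1}^{m-2}c^3_i(\pi)$. $\mathrm{maj}(\tau)=\sum_{i:\tau_i>\tau_{i+1}}i$ is the major index. -}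

module Defs where

open import Data.Nat using (ℕ; zero; suc; _+_; _∸_; _<ᵇ_)
open import Data.Bool using (Bool; true; false; if_then_else_)
open import Data.List using (List; []; _∷_; map; reverse; length)
open import Data.Fin using (Fin; toℕ)
open import Data.List using (allFin)
open import Data.Fin.Permutation using (Permutation′; _⟨$⟩ʳ_)

word : {n : ℕ} → Permutation′ n → List ℕ
word {n} σ = map (λ i → suc (toℕ (σ ⟨$⟩ʳ i))) (allFin n)

oneStar : {n : ℕ} → Permutation′ n → List ℕ
oneStar σ = 1 ∷ map suc (word σ)

revComp : {n : ℕ} → Permutation′ n → List ℕ
revComp {n} σ = reverse (map (λ x → suc n ∸ x) (word σ))

isOdd : ℕ → Bool
isOdd zero = false
isOdd (suc k) with isOdd k
... | true = false
... | false = true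

b2n : Bool → ℕ
b2n true = 1
b2n false = 0

-- number of inversions of the (distinct-valued) triple abc;
-- the standardized pattern of abc is an odd permutation of 𝔖₃
-- iff this number is odd (sign = (−1)^{#inversions}).
inv3 : ℕ → ℕ → ℕ → ℕ
inv3 a b c = b2n (b <ᵇ a) + b2n (c <ᵇ a) + b2n (c <ᵇ b)

oddPattern : ℕ → ℕ → ℕ → Bool
oddPattern a b c = isOdd (inv3 a b c)

countOdd : ℕ → ℕ → List ℕ → ℕ
countOdd a b [] = 0
countOdd a b (c ∷ cs) = b2n (oddPattern a b c) + countOdd a b cs

-- i₃(π) = Σ_{i=1}^{m-2} c³ᵢ(π), c³ᵢ(π) = #{ j > i+1 : πᵢ πᵢ₊₁ πⱼ odd }
i3 : List ℕ → ℕ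
i3 [] = 0
i3 (a ∷ []) = 0
i3 (a ∷ b ∷ rest) = countOdd a b rest + i3 (b ∷ rest)

majFrom : ℕ → List ℕ → ℕ
majFrom k [] = 0
majFrom k (a ∷ []) = 0
majFrom k (a ∷ b ∷ rest) = (if b <ᵇ a then k else 0) + majFrom (suc k) (b ∷ rest)

maj : List ℕ → ℕ
maj = majFrom 1

module Submission where

-- For a list w of length m call
--   comaj w = Σ_{i : wᵢ > wᵢ₊₁} (m − i)   and   ascentComaj w = Σ_{i : wᵢ < wᵢ₊₁} (m − i),
-- both instances of one "weighted adjacency" statistic.  For every triple a b c the pattern abc is odd
--      exactly when [c < a] + odd(abc) = [b < a] + [c < b]; summing over c
--      and then over i gives  i₃(a w) + #{c ∈ w : c < a} = comaj(a w).
--      For π = 1 * σ no entry lies below the leading 1, so i₃(1 * σ) = comaj σ.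
--  (2) Complementing the values x ↦ n + 1 − x turns descents into ascents:
--      comaj σ = ascentComaj σ′.
--  (3) Reversing a word turns an ascent at position i into a descent at
--      position m − i:  maj (reverse u) = ascentComaj u.
-- Chaining (1), (2), (3) with u = σ′ gives i₃(1 * σ) = maj(σ^r).

open import Defs
open import Data.Nat using (ℕ)
open import Data.Fin.Permutation using (Permutation′)
open import Relation.Binary.PropositionalEquality using (_≡_)

open import Data.Nat using (suc; _+_; _*_; _∸_; _<ᵇ_; _≤_)
open import Data.Nat.Properties
  using (<ᵇ-reflects-<; <⇒≱; ≮⇒≥; ≤-trans; <-trans; m≤n⇒m≤1+n; *-zeroʳ;
         ∸-monoʳ-<; ∸-monoʳ-≤; +-assoc; +-suc; +-comm; +-identityʳ)
open import Data.Nat.Tactic.RingSolver using (solve-∀)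
open import Data.Bool using (Bool; true; false; if_then_else_)
open import Data.Unit using (⊤; tt)
open import Data.Empty using (⊥-elim)
open import Data.List using (List; []; _∷_; map; reverse; length; _++_; _∷ʳ_; allFin)
open import Data.List.Properties using (unfold-reverse; ++-assoc; length-reverse; length-map)
open import Data.List.Relation.Unary.All using (All; []; _∷_; universal)
open import Data.Fin using (Fin; toℕ)
open import Data.Fin.Properties using (toℕ<n)
open import Data.Fin.Permutation using (_⟨$⟩ʳ_)
open import Relation.Nullary.Reflects using (ofʸ; ofⁿ)
open import Relation.Binary.PropositionalEquality
  using (refl; sym; trans; cong; cong₂; module ≡-Reasoning)
open ≡-Reasoning

interchange : ∀ p q r s → (p + q) + (r + s) ≡ (p + r) + (q + s)
interchange = solve-∀

exchange : ∀ p q r s → (p + q) + (r + s) ≡ (r + q) + (p + s)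
exchange = solve-∀

collect : ∀ x z m l → (x + z) + (x * m + l) ≡ x * suc m + (z + l)
collect = solve-∀

-- The weighted adjacency statistic: each adjacent pair wᵢ wᵢ₊₁ satisfying R
-- contributes its distance m − i to the end of the word.
weighted : (ℕ → ℕ → Bool) → List ℕ → ℕ
weighted R (a ∷ b ∷ rest) = b2n (R a b) * suc (length rest) + weighted R (b ∷ rest)
weighted R _ = 0

comaj : List ℕ → ℕ
comaj = weighted (λ a b → b <ᵇ a)

ascentComaj : List ℕ → ℕ
ascentComaj = weighted _<ᵇ_

countBelow : ℕ → List ℕ → ℕ
countBelow a [] = 0
countBelow a (c ∷ cs) = b2n (c <ᵇ a) + countBelow a cs

-- The sign of the pattern abc, read off its inversions: by transitivity of <
-- the pattern is odd exactly when [b<a] + [c<b] − [c<a] = 1 (this difference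
-- is always 0 or 1), so the parity of the inversion count is a plain sum.
oddPattern-inversions : ∀ a b c →
  b2n (oddPattern a b c) + b2n (c <ᵇ a) ≡ b2n (b <ᵇ a) + b2n (c <ᵇ b)
oddPattern-inversions a b c
  with b <ᵇ a | <ᵇ-reflects-< b a | c <ᵇ a | <ᵇ-reflects-< c a | c <ᵇ b | <ᵇ-reflects-< c b
... | false | _      | false | _      | false | _      = refl
... | false | _      | false | _      | true  | _      = refl
... | false | ofⁿ b≮a | true | ofʸ c<a | false | ofⁿ c≮b =
  ⊥-elim (<⇒≱ c<a (≤-trans (≮⇒≥ b≮a) (≮⇒≥ c≮b)))
... | false | _      | true  | _      | true  | _      = refl
... | true  | _      | false | _      | false | _      = refl
... | true  | ofʸ b<a | false | ofⁿ c≮a | true | ofʸ c<b =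
  ⊥-elim (c≮a (<-trans c<b b<a))
... | true  | _      | true  | _      | false | _      = refl
... | true  | _      | true  | _      | true  | _      = refl

countOdd-countBelow : ∀ a b cs →
  countOdd a b cs + countBelow a cs ≡ b2n (b <ᵇ a) * length cs + countBelow b cs
countOdd-countBelow a b [] = cong (_+ 0) (sym (*-zeroʳ (b2n (b <ᵇ a))))
countOdd-countBelow a b (c ∷ cs) = begin
  (b2n (oddPattern a b c) + countOdd a b cs) + (b2n (c <ᵇ a) + countBelow a cs)
    ≡⟨ interchange (b2n (oddPattern a b c)) (countOdd a b cs) (b2n (c <ᵇ a)) (countBelow a cs) ⟩
  (b2n (oddPattern a b c) + b2n (c <ᵇ a)) + (countOdd a b cs + countBelow a cs)
    ≡⟨ cong₂ _+_ (oddPattern-inversions a b c) (countOdd-countBelow a b cs) ⟩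
  (b2n (b <ᵇ a) + b2n (c <ᵇ b)) + (b2n (b <ᵇ a) * length cs + countBelow b cs)
    ≡⟨ collect (b2n (b <ᵇ a)) (b2n (c <ᵇ b)) (length cs) (countBelow b cs) ⟩
  b2n (b <ᵇ a) * suc (length cs) + (b2n (c <ᵇ b) + countBelow b cs) ∎

i3-comaj : ∀ a w → i3 (a ∷ w) + countBelow a w ≡ comaj (a ∷ w)
i3-comaj a [] = refl
i3-comaj a (b ∷ rest) = begin
  (countOdd a b rest + i3 (b ∷ rest)) + (b2n (b <ᵇ a) + countBelow a rest)
    ≡⟨ exchange (countOdd a b rest) (i3 (b ∷ rest)) (b2n (b <ᵇ a)) (countBelow a rest) ⟩
  (b2n (b <ᵇ a) + i3 (b ∷ rest)) + (countOdd a b rest + countBelow a rest)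
    ≡⟨ cong (b2n (b <ᵇ a) + i3 (b ∷ rest) +_) (countOdd-countBelow a b rest) ⟩
  (b2n (b <ᵇ a) + i3 (b ∷ rest)) + (b2n (b <ᵇ a) * length rest + countBelow b rest)
    ≡⟨ collect (b2n (b <ᵇ a)) (i3 (b ∷ rest)) (length rest) (countBelow b rest) ⟩
  b2n (b <ᵇ a) * suc (length rest) + (i3 (b ∷ rest) + countBelow b rest)
    ≡⟨ cong (b2n (b <ᵇ a) * suc (length rest) +_) (i3-comaj b rest) ⟩
  b2n (b <ᵇ a) * suc (length rest) + comaj (b ∷ rest) ∎

weighted-map : ∀ {P : ℕ → Set} R S (f : ℕ → ℕ) →
  (∀ {a b} → P a → P b → R (f a) (f b) ≡ S a b) →
  ∀ w → All P w → weighted R (map f w) ≡ weighted S w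
weighted-map R S f transport [] _ = refl
weighted-map R S f transport (a ∷ []) _ = refl
weighted-map R S f transport (a ∷ b ∷ rest) (pa ∷ pb ∷ ps) =
  cong₂ _+_ (cong₂ (λ t m → b2n t * suc m) (transport pa pb) (length-map f rest))
            (weighted-map R S f transport (b ∷ rest) (pb ∷ ps))

comaj-suc : ∀ w → comaj (map suc w) ≡ comaj w
comaj-suc w = weighted-map {P = λ _ → ⊤} _ _ suc (λ _ _ → refl) w (universal (λ _ → tt) w)

countBelow-one : ∀ w → countBelow 1 (map suc w) ≡ 0
countBelow-one [] = refl
countBelow-one (b ∷ rest) = countBelow-one rest

comaj-leadingOne : ∀ w → comaj (1 ∷ map suc w) ≡ comaj (map suc w)
comaj-leadingOne [] = refl
comaj-leadingOne (b ∷ rest) = refl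

i3-oneStar : ∀ w → i3 (1 ∷ map suc w) ≡ comaj w
i3-oneStar w = begin
  i3 (1 ∷ map suc w)                               ≡⟨ sym (+-identityʳ _) ⟩
  i3 (1 ∷ map suc w) + 0                           ≡⟨ cong (i3 (1 ∷ map suc w) +_) (sym (countBelow-one w)) ⟩
  i3 (1 ∷ map suc w) + countBelow 1 (map suc w)    ≡⟨ i3-comaj 1 (map suc w) ⟩
  comaj (1 ∷ map suc w)                            ≡⟨ comaj-leadingOne w ⟩
  comaj (map suc w)                                ≡⟨ comaj-suc w ⟩
  comaj w ∎

complement-<ᵇ : ∀ k {a b} → a ≤ k → b ≤ k → (k ∸ a <ᵇ k ∸ b) ≡ (b <ᵇ a)
complement-<ᵇ k {a} {b} a≤k b≤k
  with b <ᵇ a | <ᵇ-reflects-< b a | k ∸ a <ᵇ k ∸ b | <ᵇ-reflects-< (k ∸ a) (k ∸ b)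
... | true  | _       | true  | _       = refl
... | false | _       | false | _       = refl
... | true  | ofʸ b<a | false | ofⁿ k∸a≮k∸b = ⊥-elim (k∸a≮k∸b (∸-monoʳ-< b<a a≤k))
... | false | ofⁿ b≮a | true  | ofʸ k∸a<k∸b = ⊥-elim (<⇒≱ k∸a<k∸b (∸-monoʳ-≤ k (≮⇒≥ b≮a)))

ascentComaj-complement : ∀ k w → All (_≤ k) w → ascentComaj (map (k ∸_) w) ≡ comaj w
ascentComaj-complement k = weighted-map _ _ (k ∸_) (complement-<ᵇ k)

majFrom-snoc : ∀ k v l x →
  majFrom k (v ++ l ∷ x ∷ []) ≡ majFrom k (v ++ l ∷ []) + (if x <ᵇ l then k + length v else 0)
majFrom-snoc k [] l x with x <ᵇ l
... | true  = refl
... | false = refl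
majFrom-snoc k (a ∷ []) l x = cong₂ _+_ (sym (+-identityʳ _)) (secondPosition (x <ᵇ l))
  where
  secondPosition : ∀ t → (if t then suc k else 0) + 0 ≡ (if t then k + 1 else 0)
  secondPosition true  = trans (+-identityʳ (suc k)) (+-comm 1 k)
  secondPosition false = refl
majFrom-snoc k (a ∷ b ∷ v) l x = begin
  d + majFrom (suc k) (b ∷ v ++ l ∷ x ∷ [])
    ≡⟨ cong (d +_) (majFrom-snoc (suc k) (b ∷ v) l x) ⟩
  d + (majFrom (suc k) (b ∷ v ++ l ∷ []) + (if x <ᵇ l then suc k + length (b ∷ v) else 0))
    ≡⟨ sym (+-assoc d _ _) ⟩
  d + majFrom (suc k) (b ∷ v ++ l ∷ []) + (if x <ᵇ l then suc k + length (b ∷ v) else 0)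
    ≡⟨ cong (λ p → d + majFrom (suc k) (b ∷ v ++ l ∷ []) + (if x <ᵇ l then p else 0))
            (sym (+-suc k (length (b ∷ v)))) ⟩
  d + majFrom (suc k) (b ∷ v ++ l ∷ []) + (if x <ᵇ l then k + length (a ∷ b ∷ v) else 0) ∎
  where d = if b <ᵇ a then k else 0

-- Reversal carries an ascent at position i of u to a descent at position m − i.
maj-reverse : ∀ u → maj (reverse u) ≡ ascentComaj u
maj-reverse [] = refl
maj-reverse (a ∷ []) = refl
maj-reverse (a ∷ b ∷ rest) = begin
  maj (reverse (a ∷ b ∷ rest))
    ≡⟨ cong maj (trans (unfold-reverse a (b ∷ rest)) (cong (_∷ʳ a) (unfold-reverse b rest))) ⟩
  maj ((reverse rest ++ b ∷ []) ++ a ∷ [])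
    ≡⟨ cong maj (++-assoc (reverse rest) (b ∷ []) (a ∷ [])) ⟩
  maj (reverse rest ++ b ∷ a ∷ [])
    ≡⟨ majFrom-snoc 1 (reverse rest) b a ⟩
  maj (reverse rest ++ b ∷ []) + (if a <ᵇ b then suc (length (reverse rest)) else 0)
    ≡⟨ cong₂ _+_ (trans (cong maj (sym (unfold-reverse b rest))) (maj-reverse (b ∷ rest)))
                 (lastPosition (a <ᵇ b)) ⟩
  ascentComaj (b ∷ rest) + b2n (a <ᵇ b) * suc (length rest)
    ≡⟨ +-comm (ascentComaj (b ∷ rest)) _ ⟩
  ascentComaj (a ∷ b ∷ rest) ∎
  where
  -- the pair b a sits at position |rest| + 1 of the reversed word
  lastPosition : ∀ t → (if t then suc (length (reverse rest)) else 0) ≡ b2n t * suc (length rest)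
  lastPosition true  = trans (cong suc (length-reverse rest)) (sym (+-identityʳ _))
  lastPosition false = refl

word-bounded : ∀ {n} (σ : Permutation′ n) → All (_≤ suc n) (word σ)
word-bounded {n} σ = bounded (allFin n)
  where
  bounded : (is : List (Fin n)) → All (_≤ suc n) (map (λ i → suc (toℕ (σ ⟨$⟩ʳ i))) is)
  bounded [] = []
  bounded (i ∷ is) = m≤n⇒m≤1+n (toℕ<n (σ ⟨$⟩ʳ i)) ∷ bounded is

proposition3p11 : (n : ℕ) (σ : Permutation′ n) → i3 (oneStar σ) ≡ maj (revComp σ)
proposition3p11 n σ = begin
  i3 (oneStar σ)                          ≡⟨ i3-oneStar (word σ) ⟩
  comaj (word σ)                          ≡⟨ sym (ascentComaj-complement (suc n) (word σ) (word-bounded σ)) ⟩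
  ascentComaj (map (suc n ∸_) (word σ))   ≡⟨ sym (maj-reverse (map (suc n ∸_) (word σ))) ⟩
  maj (revComp σ)                         ∎
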